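{- With $\varepsilon,\varphi$ the numbers of $-$ and $+$ signs in the reduced sequence $\mathsf{s}^{\rm red}$ associated to $(T_1,T_2)\in SST_{\mathcal{A}/\mathcal{B}}(k_1)\times SST_{\mathcal{A}/\mathcal{B}}(k_2)$, we have $\varphi-\varepsilon = k_1-k_2$.
   Context: $\mathcal{A},\mathcal{B}$ are disjoint countable $\mathbb{Z}_2$-graded totally ordered sets. $SST_{\mathcal{A}/\mathcal{B}}(k)$ ($k\in\mathbb{Z}$) is the set of parabolically semistandard tableaux of level 1 and shape $k$: pairs $(T^+,T^-)$ with $T^+\in SST_{\mathcal{A}}((k+d)/\mu)$, $T^-\in SST_{\mathcal{B}}((d)/\mu)$ for some $d\ge0$, $\mu\le d$, $\mu\le k+d$, with weight ${\rm wt}(T^+)-{\rm wt}(T^-)$. Let $T_j=(T_j^+,T_j^-)\in SST_{\mathcal{A}/\mathcal{B}}(k_j)$, $j=1,2$, with ${\rm wt}_{\mathcal{A}/\mathcal{B}}(T_j)=\sum_{a\in\mathcal{A}}m_{aj}\epsilon_a-\sum_{b\in\mathcal{B}}m_{bj}\epsilon_b$. Choose finite $\mathcal{A}^\circ=\{a_k>\cdots>a_1\}\subset\mathcal{A}$, $\mathcal{B}^\circ=\{b_1<\cdots<b_l\}\subset\mathcal{B}$ containing all entries. To $i$ assign the sign sequence $\mathsf s_i$: $(-)^{m_{i2}}(+)^{m_{i1}}$ if $i\in\mathcal{A}_0$; $(+)^{m_{i1}}(-)^{m_{i2}}$ if $i\in\mathcal{A}_1$; $(-)^{m_{i1}}(+)^{m_{i2}}$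 if $i\in\mathcal{B}_0$; $(+)^{m_{i2}}(-)^{m_{i1}}$ if $i\in\mathcal{B}_1$. Let $\mathsf s=(\mathsf s_{a_k}\cdots\mathsf s_{a_1}\mathsf s_{b_1}\cdots\mathsf s_{b_l})$ and cancel $(+\ -)$ pairs as far as possible to get $\mathsf s^{\rm red}=((-)^{\varepsilon}(+)^{\varphi})$. -}

module Defs where

open import Data.Nat using (ℕ)
open import Data.Integer using (ℤ; +_; _+_; _-_)
open import Data.List using (List; []; _∷_; _++_; replicate; concatMap; length; filter)
open import Data.List.Relation.Unary.Linked using (Linked)
open import Data.List.Relation.Unary.All using (All)
open import Data.List.Relation.Unary.AllPairs using (AllPairs)
open import Data.List.Membership.Propositional using (_∈_)
open import Data.Product using (_×_)
open import Data.Sum using (_⊎_)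
open import Relation.Binary using (IsStrictTotalOrder)
open import Relation.Binary.PropositionalEquality using (_≡_)
open import Relation.Binary.Construct.Closure.ReflexiveTransitive using (Star)
open import Function.Bundles using (Injection)
open import Function.Bundles using (_↣_)
open import Level using (0ℓ)

data ℤ₂ : Set where
  0̄ 1̄ : ℤ₂

record GradedSet : Set₁ where
  field
    Carrier   : Set
    _<_       : Carrier → Carrier → Set
    isSTO     : IsStrictTotalOrder _≡_ _<_
    parity    : Carrier → ℤ₂
    countable : Carrier ↣ ℕ

  open IsStrictTotalOrder isSTO public using (_≟_)

  -- ordering condition along a row of a ℤ₂-graded semistandard tableau:
  -- weakly increasing, with odd entries not repeated
  RowRel : Carrier → Carrier → Set
  RowRel x y = (x < y) ⊎ ((x ≡ y) × (parity x ≡ 0̄))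

  SSTRow : List Carrier → Set
  SSTRow = Linked RowRel

  mult : Carrier → List Carrier → ℕ
  mult a w = length (filter (_≟ a) w)

open GradedSet

-- Parabolically semistandard tableau of level 1 and shape k:
-- T⁺ ∈ SST_A((k+d)/μ), T⁻ ∈ SST_B((d)/μ), d ≥ 0, μ ≤ d, μ ≤ k+d.
-- One-row skew shape (n)/(μ) has n - μ boxes, filled by a row word.
record SSTAB (𝒜 ℬ : GradedSet) (k : ℤ) : Set where
  field
    d     : ℕ
    μ     : ℕ
    μ≤d   : μ Data.Nat.≤ d
    μ≤k+d : + μ Data.Integer.≤ k + + d
    T⁺    : List (Carrier 𝒜)
    T⁻    : List (Carrier ℬ)
    T⁺-shape : + length T⁺ ≡ (k + + d) - + μ
    T⁻-shape : length T⁻ Data.Nat.+ μ ≡ d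
    T⁺-sst : SSTRow 𝒜 T⁺
    T⁻-sst : SSTRow ℬ T⁻

data Sign : Set where
  ⊕ ⊖ : Sign

-- sign sequences s_i (m₁ = multiplicity in T₁, m₂ = multiplicity in T₂)
signA : ℤ₂ → ℕ → ℕ → List Sign
signA 0̄ m₁ m₂ = replicate m₂ ⊖ ++ replicate m₁ ⊕
signA 1̄ m₁ m₂ = replicate m₁ ⊕ ++ replicate m₂ ⊖

signB : ℤ₂ → ℕ → ℕ → List Sign
signB 0̄ m₁ m₂ = replicate m₁ ⊖ ++ replicate m₂ ⊕
signB 1̄ m₁ m₂ = replicate m₂ ⊕ ++ replicate m₁ ⊖

module _ {𝒜 ℬ : GradedSet} {k₁ k₂ : ℤ} where
  open SSTAB

  -- s = s_{a_k} ⋯ s_{a_1} s_{b_1} ⋯ s_{b_l}, where the list A° is a_k,…,a_1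
  -- and B° is b_1,…,b_l
  signSeq : SSTAB 𝒜 ℬ k₁ → SSTAB 𝒜 ℬ k₂ →
            List (Carrier 𝒜) → List (Carrier ℬ) → List Sign
  signSeq T₁ T₂ A° B° =
    concatMap (λ a → signA (parity 𝒜 a) (mult 𝒜 a (T⁺ T₁)) (mult 𝒜 a (T⁺ T₂))) A°
    ++ concatMap (λ b → signB (parity ℬ b) (mult ℬ b (T⁻ T₁)) (mult ℬ b (T⁻ T₂))) B°

data CancelStep : List Sign → List Sign → Set where
  cancel : ∀ xs ys → CancelStep (xs ++ ⊕ ∷ ⊖ ∷ ys) (xs ++ ys)

_reducesTo_,_ : List Sign → ℕ → ℕ → Set
s reducesTo ε , φ = Star CancelStep s (replicate ε ⊖ ++ replicate φ ⊕)

module Submission where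

open import Defs
open import Data.Nat using (ℕ)
open import Data.Integer using (ℤ; +_; _-_)
open import Data.List using (List)
open import Data.List.Relation.Unary.All using (All)
open import Data.List.Relation.Unary.AllPairs using (AllPairs)
open import Data.List.Membership.Propositional using (_∈_)
open import Relation.Binary.PropositionalEquality using (_≡_)

import Data.Nat as ℕ
open import Data.Integer using (0ℤ; 1ℤ; -1ℤ; _+_; -_)
open import Data.Integer.Properties using (+-assoc; +-identityˡ; +-comm; neg-distrib-+)
import Data.Integer.Tactic.RingSolver as ℤ-Ring
import Data.Nat.Tactic.RingSolver as ℕ-Ring
open import Data.List using ([]; _∷_; [_]; _++_; replicate; concatMap; map; length)
open import Data.Nat.ListAction using (sum)
open import Data.List.Relation.Unary.All using ([]; _∷_; lookup; universal)
import Data.List.Relation.Unary.All as All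
open import Data.List.Relation.Unary.Any using (here; there)
import Data.List.Relation.Unary.AllPairs as AllPairs
open import Data.List.Relation.Unary.AllPairs using (_∷_)
open import Data.List.Relation.Unary.Unique.Propositional using (Unique)
open import Relation.Binary.Construct.Closure.ReflexiveTransitive using (Star; ε; _◅_)
open import Relation.Binary.PropositionalEquality using (_≢_; refl; sym; trans; cong; cong₂; module ≡-Reasoning)
open import Relation.Binary.Structures using (IsStrictTotalOrder)
open import Relation.Nullary using (yes; no)
open import Data.Empty using (⊥-elim)

-- Give every sign sequence its charge, (number of ⊕) − (number
-- of ⊖), an integer.  Charge is additive under concatenation, so cancelling
-- an adjacent (⊕ ⊖) pair does not change it; hence a sequence s reducing to
-- (⊖)^ε (⊕)^φ has charge φ − ε.  On the other hand the charge of the block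
-- s_i is m_{i1} − m_{i2} for i ∈ A and m_{i2} − m_{i1} for i ∈ B, whatever
-- the parity of i.  Summing over the distinct letters of A° (resp. B°), which
-- contain all entries, the multiplicities add up to the lengths of the rows,
-- so the charge of s is (|T₁⁺| − |T₂⁺|) + (|T₂⁻| − |T₁⁻|).  Finally the shape
-- constraints of a tableau of shape k give k = |T⁺| − |T⁻|, and the theorem
-- follows by rearranging.

charge : List Sign → ℤ
charge []      = 0ℤ
charge (⊕ ∷ s) = 1ℤ + charge s
charge (⊖ ∷ s) = -1ℤ + charge s

charge-++ : ∀ xs ys → charge (xs ++ ys) ≡ charge xs + charge ys
charge-++ []       ys = sym (+-identityˡ (charge ys))
charge-++ (⊕ ∷ xs) ys = trans (cong (_+_ 1ℤ) (charge-++ xs ys)) (sym (+-assoc 1ℤ (charge xs) (charge ys)))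
charge-++ (⊖ ∷ xs) ys = trans (cong (_+_ -1ℤ) (charge-++ xs ys)) (sym (+-assoc -1ℤ (charge xs) (charge ys)))

charge-cancel : ∀ {s t} → CancelStep s t → charge s ≡ charge t
charge-cancel (cancel xs ys) = begin
  charge (xs ++ ⊕ ∷ ⊖ ∷ ys)              ≡⟨ charge-++ xs (⊕ ∷ ⊖ ∷ ys) ⟩
  charge xs + (1ℤ + (-1ℤ + charge ys))  ≡⟨ cong (_+_ (charge xs)) pair-vanishes ⟩
  charge xs + charge ys                 ≡⟨ charge-++ xs ys ⟨
  charge (xs ++ ys)                     ∎
  where
  open ≡-Reasoning
  pair-vanishes : 1ℤ + (-1ℤ + charge ys) ≡ charge ys
  pair-vanishes = trans (sym (+-assoc 1ℤ -1ℤ (charge ys))) (+-identityˡ (charge ys))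

charge-reduce : ∀ {s t} → Star CancelStep s t → charge s ≡ charge t
charge-reduce ε            = refl
charge-reduce (step ◅ red) = trans (charge-cancel step) (charge-reduce red)

charge-⊕ⁿ : ∀ n → charge (replicate n ⊕) ≡ + n
charge-⊕ⁿ ℕ.zero    = refl
charge-⊕ⁿ (ℕ.suc n) = cong (_+_ 1ℤ) (charge-⊕ⁿ n)

charge-⊖ⁿ : ∀ n → charge (replicate n ⊖) ≡ - + n
charge-⊖ⁿ ℕ.zero    = refl
charge-⊖ⁿ (ℕ.suc n) = trans (cong (_+_ -1ℤ) (charge-⊖ⁿ n)) (sym (neg-distrib-+ 1ℤ (+ n)))

charge-⊕ⁿ⊖ᵐ : ∀ n m → charge (replicate n ⊕ ++ replicate m ⊖) ≡ + n - + m
charge-⊕ⁿ⊖ᵐ n m = trans (charge-++ (replicate n ⊕) (replicate m ⊖)) (cong₂ _+_ (charge-⊕ⁿ n) (charge-⊖ⁿ m))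

charge-⊖ᵐ⊕ⁿ : ∀ m n → charge (replicate m ⊖ ++ replicate n ⊕) ≡ + n - + m
charge-⊖ᵐ⊕ⁿ m n = begin
  charge (replicate m ⊖ ++ replicate n ⊕) ≡⟨ charge-++ (replicate m ⊖) (replicate n ⊕) ⟩
  charge (replicate m ⊖) + charge (replicate n ⊕) ≡⟨ cong₂ _+_ (charge-⊖ⁿ m) (charge-⊕ⁿ n) ⟩
  - + m + + n ≡⟨ +-comm (- + m) (+ n) ⟩
  + n - + m ∎
  where open ≡-Reasoning

charge-signA : ∀ p m₁ m₂ → charge (signA p m₁ m₂) ≡ + m₁ - + m₂
charge-signA 0̄ m₁ m₂ = charge-⊖ᵐ⊕ⁿ m₂ m₁
charge-signA 1̄ m₁ m₂ = charge-⊕ⁿ⊖ᵐ m₁ m₂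

charge-signB : ∀ p m₁ m₂ → charge (signB p m₁ m₂) ≡ + m₂ - + m₁
charge-signB 0̄ m₁ m₂ = charge-⊖ᵐ⊕ⁿ m₁ m₂
charge-signB 1̄ m₁ m₂ = charge-⊕ⁿ⊖ᵐ m₂ m₁

charge-concatMap : ∀ {A : Set} (f : A → List Sign) (g h : A → ℕ) →
  (∀ a → charge (f a) ≡ + g a - + h a) →
  ∀ as → charge (concatMap f as) ≡ + sum (map g as) - + sum (map h as)
charge-concatMap f g h charge-f []       = refl
charge-concatMap f g h charge-f (a ∷ as) = begin
  charge (f a ++ concatMap f as)          ≡⟨ charge-++ (f a) (concatMap f as) ⟩
  charge (f a) + charge (concatMap f as)  ≡⟨ cong₂ _+_ (charge-f a) (charge-concatMap f g h charge-f as) ⟩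
  (+ g a - + h a) + (+ G - + H)           ≡⟨ differences-add (+ g a) (+ h a) (+ G) (+ H) ⟩
  (+ g a + + G) - (+ h a + + H)           ∎
  where
  open ≡-Reasoning
  G H : ℕ
  G = sum (map g as)
  H = sum (map h as)
  differences-add : ∀ w x y z → (w - x) + (y - z) ≡ (w + y) - (x + z)
  differences-add = ℤ-Ring.solve-∀

sum-map-+ : ∀ {A : Set} (f g h : A → ℕ) → (∀ a → f a ≡ g a ℕ.+ h a) →
  ∀ as → sum (map f as) ≡ sum (map g as) ℕ.+ sum (map h as)
sum-map-+ f g h f≡g+h []       = refl
sum-map-+ f g h f≡g+h (a ∷ as) = begin
  f a ℕ.+ sum (map f as)                                ≡⟨ cong₂ ℕ._+_ (f≡g+h a) (sum-map-+ f g h f≡g+h as) ⟩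
  (g a ℕ.+ h a) ℕ.+ (sum (map g as) ℕ.+ sum (map h as))  ≡⟨ medial (g a) (h a) _ _ ⟩
  (g a ℕ.+ sum (map g as)) ℕ.+ (h a ℕ.+ sum (map h as))  ∎
  where
  open ≡-Reasoning
  medial : ∀ w x y z → (w ℕ.+ x) ℕ.+ (y ℕ.+ z) ≡ (w ℕ.+ y) ℕ.+ (x ℕ.+ z)
  medial = ℕ-Ring.solve-∀

sum-map-zero : ∀ {A : Set} (f : A → ℕ) {as} → All (λ a → f a ≡ 0) as → sum (map f as) ≡ 0
sum-map-zero f []           = refl
sum-map-zero f (fa≡0 ∷ rest) = cong₂ ℕ._+_ fa≡0 (sum-map-zero f rest)

module Letters (G : GradedSet) where
  open GradedSet G

  increasing⇒unique : ∀ {as} → AllPairs _<_ as → Unique as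
  increasing⇒unique = AllPairs.map λ x<y x≡y → IsStrictTotalOrder.irrefl isSTO x≡y x<y

  decreasing⇒unique : ∀ {as} → AllPairs (λ x y → y < x) as → Unique as
  decreasing⇒unique = AllPairs.map λ y<x x≡y → IsStrictTotalOrder.irrefl isSTO (sym x≡y) y<x

  mult-[x]-≡ : ∀ x → mult x [ x ] ≡ 1
  mult-[x]-≡ x with x ≟ x
  ... | yes _   = refl
  ... | no x≢x  = ⊥-elim (x≢x refl)

  mult-[x]-≢ : ∀ {x a} → x ≢ a → mult a [ x ] ≡ 0
  mult-[x]-≢ {x} {a} x≢a with x ≟ a
  ... | yes x≡a = ⊥-elim (x≢a x≡a)
  ... | no _    = refl

  mult-∷ : ∀ x T a → mult a (x ∷ T) ≡ mult a [ x ] ℕ.+ mult a T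
  mult-∷ x T a with x ≟ a
  ... | yes _ = refl
  ... | no _  = refl

  count-absent : ∀ {x} as → All (x ≢_) as → sum (map (λ a → mult a [ x ]) as) ≡ 0
  count-absent {x} as x∉as = sum-map-zero (λ a → mult a [ x ]) (All.map mult-[x]-≢ x∉as)

  count-single : ∀ {x as} → Unique as → x ∈ as → sum (map (λ a → mult a [ x ]) as) ≡ 1
  count-single {x} (x∉as ∷ _) (here refl) = cong₂ ℕ._+_ (mult-[x]-≡ x) (count-absent _ x∉as)
  count-single {x} (a∉as ∷ unique) (there x∈as) =
    cong₂ ℕ._+_ (mult-[x]-≢ λ x≡a → lookup a∉as x∈as (sym x≡a)) (count-single unique x∈as)

  count-word : ∀ {as} T → Unique as → All (_∈ as) T → sum (map (λ a → mult a T) as) ≡ length T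
  count-word {as} [] _ _ = sum-map-zero (λ a → mult a []) (universal (λ _ → refl) as)
  count-word {as} (x ∷ T) unique (x∈as ∷ T⊆as) = begin
    sum (map (λ a → mult a (x ∷ T)) as)                                 ≡⟨ sum-map-+ _ _ _ (mult-∷ x T) as ⟩
    sum (map (λ a → mult a [ x ]) as) ℕ.+ sum (map (λ a → mult a T) as) ≡⟨ cong₂ ℕ._+_ (count-single unique x∈as) (count-word T unique T⊆as) ⟩
    ℕ.suc (length T)                                                    ∎
    where open ≡-Reasoning

  charge-blocks : (sig : ℤ₂ → ℕ → ℕ → List Sign) →
    (∀ p m₁ m₂ → charge (sig p m₁ m₂) ≡ + m₁ - + m₂) →
    ∀ {as} T₁ T₂ → Unique as → All (_∈ as) T₁ → All (_∈ as) T₂ →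
    charge (concatMap (λ a → sig (parity a) (mult a T₁) (mult a T₂)) as) ≡ + length T₁ - + length T₂
  charge-blocks sig charge-sig {as} T₁ T₂ unique T₁⊆as T₂⊆as = begin
    charge (concatMap (λ a → sig (parity a) (mult a T₁) (mult a T₂)) as)
      ≡⟨ charge-concatMap _ (λ a → mult a T₁) (λ a → mult a T₂) (λ a → charge-sig (parity a) _ _) as ⟩
    + sum (map (λ a → mult a T₁) as) - + sum (map (λ a → mult a T₂) as)
      ≡⟨ cong₂ (λ m n → + m - + n) (count-word T₁ unique T₁⊆as) (count-word T₂ unique T₂⊆as) ⟩
    + length T₁ - + length T₂ ∎
    where open ≡-Reasoning

shape-length : ∀ {𝒜 ℬ k} (T : SSTAB 𝒜 ℬ k) → k ≡ + length (SSTAB.T⁺ T) - + length (SSTAB.T⁻ T)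
shape-length {k = k} T = sym (begin
  + length T⁺ - + N                 ≡⟨ cong (λ z → z - + N) T⁺-shape ⟩
  (k + + d) - + μ - + N             ≡⟨ cong (λ e → (k + + e) - + μ - + N) T⁻-shape ⟨
  (k + (+ N + + μ)) - + μ - + N     ≡⟨ cancel-μ-N k (+ N) (+ μ) ⟩
  k                                 ∎)
  where
  open SSTAB T
  open ≡-Reasoning
  N : ℕ
  N = length T⁻
  cancel-μ-N : ∀ k n m → (k + (n + m)) - m - n ≡ k
  cancel-μ-N = ℤ-Ring.solve-∀

lemma4p1 : (𝒜 ℬ : GradedSet) (k₁ k₂ : ℤ)
    (T₁ : SSTAB 𝒜 ℬ k₁) (T₂ : SSTAB 𝒜 ℬ k₂)
    (A° : List (GradedSet.Carrier 𝒜)) (B° : List (GradedSet.Carrier ℬ)) →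
    AllPairs (λ x y → GradedSet._<_ 𝒜 y x) A° →
    AllPairs (GradedSet._<_ ℬ) B° →
    All (_∈ A°) (SSTAB.T⁺ T₁) → All (_∈ A°) (SSTAB.T⁺ T₂) →
    All (_∈ B°) (SSTAB.T⁻ T₁) → All (_∈ B°) (SSTAB.T⁻ T₂) →
    (ε φ : ℕ) → signSeq T₁ T₂ A° B° reducesTo ε , φ →
    + φ - + ε ≡ k₁ - k₂
lemma4p1 𝒜 ℬ k₁ k₂ T₁ T₂ A° B° A°-decr B°-incr T₁⁺⊆A° T₂⁺⊆A° T₁⁻⊆B° T₂⁻⊆B° e f red = begin
  + f - + e                                      ≡⟨ charge-⊖ᵐ⊕ⁿ e f ⟨
  charge (replicate e ⊖ ++ replicate f ⊕)        ≡⟨ charge-reduce red ⟨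
  charge (signSeq T₁ T₂ A° B°)                   ≡⟨ charge-++ sA sB ⟩
  charge sA + charge sB                          ≡⟨ cong₂ _+_ charge-A-part charge-B-part ⟩
  (+ P₁ - + P₂) + (+ N₂ - + N₁)                  ≡⟨ regroup (+ P₁) (+ P₂) (+ N₁) (+ N₂) ⟩
  (+ P₁ - + N₁) - (+ P₂ - + N₂)                  ≡⟨ cong₂ _-_ (shape-length T₁) (shape-length T₂) ⟨
  k₁ - k₂                                        ∎
  where
  open SSTAB
  open ≡-Reasoning
  module A = Letters 𝒜
  module B = Letters ℬ
  P₁ P₂ N₁ N₂ : ℕ
  P₁ = length (T⁺ T₁)
  P₂ = length (T⁺ T₂)
  N₁ = length (T⁻ T₁)
  N₂ = length (T⁻ T₂)
  sA : List Sign
  sA = concatMap (λ a → signA (GradedSet.parity 𝒜 a) (GradedSet.mult 𝒜 a (T⁺ T₁)) (GradedSet.mult 𝒜 a (T⁺ T₂))) A°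
  sB : List Sign
  sB = concatMap (λ b → signB (GradedSet.parity ℬ b) (GradedSet.mult ℬ b (T⁻ T₁)) (GradedSet.mult ℬ b (T⁻ T₂))) B°
  charge-A-part : charge sA ≡ + P₁ - + P₂
  charge-A-part = A.charge-blocks signA charge-signA (T⁺ T₁) (T⁺ T₂) (A.decreasing⇒unique A°-decr) T₁⁺⊆A° T₂⁺⊆A°
  -- the B-blocks have charge m₂ − m₁, so the roles of T₁ and T₂ swap
  charge-B-part : charge sB ≡ + N₂ - + N₁
  charge-B-part = B.charge-blocks (λ p m₂ m₁ → signB p m₁ m₂) (λ p m₂ m₁ → charge-signB p m₁ m₂)
    (T⁻ T₂) (T⁻ T₁) (B.increasing⇒unique B°-incr) T₂⁻⊆B° T₁⁻⊆B°
  regroup : ∀ p₁ p₂ n₁ n₂ → (p₁ - p₂) + (n₂ - n₁) ≡ (p₁ - n₁) - (p₂ - n₂)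
  regroup = ℤ-Ring.solve-∀
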